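{- Let $M[P,Q]$ be a connected lattice path matroid of rank $r$ with at least two elements. An element $x$ of $M[P,Q]$ is in a spanning circuit of $M[P,Q]$ if and only if $x$ is in at least two of the sets $N_1,\ldots,N_r$, or $x$ is in $N_1$ or in $N_r$.
   Context: Lattice paths start at $(0,0)$ and use steps $E=(1,0)$ and $N=(0,1)$. For lattice paths $P,Q$ from $(0,0)$ to $(m,r)$ with $P$ never going above $Q$, let $\mathcal{P}$ be the set of lattice paths from $(0,0)$ to $(m,r)$ going neither above $Q$ nor below $P$, and for $1\le i\le r$ let $N_i=\{j:\text{step } j \text{ is the } i\text{ -th North step of some path in }\mathcal{P}\}$. $M[P,Q]$ is the transversal matroid on $[m+r]$ with presentation $(N_1,\ldots,N_r)$. A spanning circuit is a circuit that spans the matroid. -}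

module Defs where

open import Data.Nat using (ℕ; zero; suc; _+_; _≤_)
open import Data.Bool using (Bool; true; false; if_then_else_)
open import Data.Fin using (Fin; toℕ)
open import Data.Fin.Subset using (Subset; _∈_; _∉_; _⊆_; _⊂_; ⁅_⁆; _∪_)
open import Data.Vec using (Vec; []; _∷_; lookup)
open import Data.Product using (Σ; _×_; ∃)
open import Relation.Binary.PropositionalEquality using (_≡_)
open import Relation.Nullary using (¬_)

-- A step sequence: true = North step N=(0,1), false = East step E=(1,0).
-- Steps are indexed 0-based by Fin (m + r) (step j+1 in the paper).

prefixN : {n : ℕ} → Vec Bool n → ℕ → ℕ
prefixN []       k       = 0
prefixN (b ∷ v)  zero    = 0
prefixN (b ∷ v)  (suc k) = (if b then 1 else 0) + prefixN v k

-- lattice path from (0,0) to (m,r): m+r steps, exactly r of them North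
IsPath : (m r : ℕ) → Vec Bool (m + r) → Set
IsPath m r v = prefixN v (m + r) ≡ r

-- P never goes above Q (both from (0,0) to (m,r)): after every number of
-- steps, P has made at most as many North steps as Q.
Below : {n : ℕ} → Vec Bool n → Vec Bool n → Set
Below P Q = ∀ k → prefixN P k ≤ prefixN Q k

InRegion : (m r : ℕ) → (P Q R : Vec Bool (m + r)) → Set
InRegion m r P Q R = IsPath m r R × Below P R × Below R Q

-- j ∈ N_{i+1} (i : Fin r 0-based): step j is the (i+1)-th North step of some path in 𝒫
InN : (m r : ℕ) → (P Q : Vec Bool (m + r)) → Fin r → Fin (m + r) → Set
InN m r P Q i j =
  Σ (Vec Bool (m + r)) λ R →
    InRegion m r P Q R × (lookup R j ≡ true) × (prefixN R (toℕ j) ≡ toℕ i)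

-- Transversal matroid M[P,Q] with presentation (N_1,…,N_r):
-- I is independent iff it is a partial transversal, i.e. there is a map
-- φ : I → [r], injective on I, with x ∈ N_{φ(x)} for x ∈ I.
Independent : (m r : ℕ) → (P Q : Vec Bool (m + r)) → Subset (m + r) → Set
Independent m r P Q I =
  Σ (Fin (m + r) → Fin r) λ φ →
    (∀ x → x ∈ I → InN m r P Q (φ x) x) ×
    (∀ x y → x ∈ I → y ∈ I → φ x ≡ φ y → x ≡ y)

Circuit : (m r : ℕ) → (P Q : Vec Bool (m + r)) → Subset (m + r) → Set
Circuit m r P Q C =
  ¬ Independent m r P Q C × (∀ D → D ⊂ C → Independent m r P Q D)

Basis : (m r : ℕ) → (P Q : Vec Bool (m + r)) → Subset (m + r) → Set
Basis m r P Q B =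
  Independent m r P Q B × (∀ y → y ∉ B → ¬ Independent m r P Q (⁅ y ⁆ ∪ B))

Spanning : (m r : ℕ) → (P Q : Vec Bool (m + r)) → Subset (m + r) → Set
Spanning m r P Q S = Σ (Subset (m + r)) λ B → B ⊆ S × Basis m r P Q B

SpanningCircuit : (m r : ℕ) → (P Q : Vec Bool (m + r)) → Subset (m + r) → Set
SpanningCircuit m r P Q C = Circuit m r P Q C × Spanning m r P Q C

Connected : (m r : ℕ) → (P Q : Vec Bool (m + r)) → Set
Connected m r P Q =
  ∀ x y → ¬ (x ≡ y) →
    Σ (Subset (m + r)) λ C → Circuit m r P Q C × x ∈ C × y ∈ C

{-# OPTIONS --safe #-}
-- Let hP k and hQ k be the numbers of North steps among the first k steps of P and Q. Then
-- N_(i+1) is the interval of steps j with hP j ≤ i < hQ (j + 1), so a set is independent iff its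
-- elements can be matched to distinct such intervals. For a set S and a window [u, v] of steps this
-- gives Hall's condition hP u + |S ∩ [u, v]| ≤ hQ (v + 1), and the greedy matching shows that every
-- dependent set violates it on some window [s, e] with s, e ∈ S.
--
-- If x lies in a spanning circuit C, minimality puts C inside its violating window, and maximality of a
-- basis B ⊆ C forces hP s = 0 and hQ (e + 1) = r (otherwise the first North step of Q, or the last of P,
-- would extend B). Hall's condition for C − e on [s, x] and for C − s on [x, e] then puts x in N_1,
-- in N_r, or in two consecutive sets.
--
-- Conversely, connectivity keeps P strictly below Q between the endpoints. An x in N_1, in N_r, or in
-- two sets admits a height k such that the North steps of Q below height k before x, x itself, and the
-- North steps of P from height k on after x form a set C of r + 1 elements of distinct heights
-- 0, …, r; deleting any element y and lowering the heights above y by one matches C − y, and C − x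
-- is a basis because any r + 1 elements are dependent.
module Submission where

open import Defs
open import Data.Bool using (Bool; true; false; if_then_else_; T)
import Data.Bool.Properties as Boolₚ
open Boolₚ using (T-≡)
open import Data.Empty using (⊥-elim)
open import Data.Fin using (Fin; toℕ; fromℕ<)
import Data.Fin.Properties as Finₚ
open Finₚ using (toℕ-fromℕ<; fromℕ<-toℕ; toℕ<n; toℕ-injective; nonZeroIndex; pigeonhole)
open import Data.Fin.Subset using (Subset; _∈_; _∉_; _⊆_; _⊂_; _-_; ⁅_⁆; _∪_)
open import Data.Fin.Subset.Properties
  using (x∈p⇒p-x⊂p; x∈p∧x≢y⇒x∈p-y; p─q⊆p; x∈p∪q⁺; x∈p∪q⁻; x∈⁅x⁆; x∈⁅y⁆⇒x≡y)
open import Data.Nat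
open import Data.Nat.Properties
open import Algebra.Properties.CommutativeSemigroup +-commutativeSemigroup using (x∙yz≈y∙xz)
open import Data.Product using (Σ; ∃; _×_; _,_; proj₁; proj₂)
open import Data.Sum using (_⊎_; inj₁; inj₂)
open import Data.Vec using (Vec; []; _∷_; lookup; tabulate)
open import Data.Vec.Properties using ([]=⇒lookup; lookup⇒[]=; lookup∘tabulate)
open import Function using (_∘_)
open import Function.Bundles using (Equivalence; _⇔_; mk⇔)
open import Relation.Binary.PropositionalEquality
open import Relation.Binary.Definitions using (tri<; tri≈; tri>)
open import Relation.Nullary using (¬_; Dec; yes; no)
open import Relation.Nullary.Decidable using (⌊_⌋; _×-dec_; _⊎-dec_; toWitness; fromWitness)

bit : Bool → ℕ
bit b = if b then 1 else 0

bit≤1 : ∀ b → bit b ≤ 1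
bit≤1 true  = ≤-refl
bit≤1 false = z≤n

lookupℕ : ∀ {n} → Vec Bool n → ℕ → Bool
lookupℕ []      _       = false
lookupℕ (b ∷ v) zero    = b
lookupℕ (b ∷ v) (suc j) = lookupℕ v j

lookupℕ-toℕ : ∀ {n} (v : Vec Bool n) (x : Fin n) → lookupℕ v (toℕ x) ≡ lookup v x
lookupℕ-toℕ (b ∷ v) Fin.zero    = refl
lookupℕ-toℕ (b ∷ v) (Fin.suc x) = lookupℕ-toℕ v x

lookupℕ-true⇒< : ∀ {n} (v : Vec Bool n) {j} → lookupℕ v j ≡ true → j < n
lookupℕ-true⇒< (b ∷ v) {zero}  _  = s≤s z≤n
lookupℕ-true⇒< (b ∷ v) {suc j} vj = s≤s (lookupℕ-true⇒< v vj)

lookupℕ-fromℕ< : ∀ {n} (v : Vec Bool n) {j} (j<n : j < n) → lookupℕ v j ≡ lookup v (fromℕ< j<n)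
lookupℕ-fromℕ< v j<n = trans (cong (lookupℕ v) (sym (toℕ-fromℕ< j<n))) (lookupℕ-toℕ v _)

lookupℕ-tabulate : ∀ {n} (g : ℕ → Bool) {j} → j < n → lookupℕ (tabulate {n = n} (g ∘ toℕ)) j ≡ g j
lookupℕ-tabulate {n} g {j} j<n = begin
  lookupℕ (tabulate {n = n} (g ∘ toℕ)) j   ≡⟨ lookupℕ-fromℕ< (tabulate (g ∘ toℕ)) j<n ⟩
  lookup (tabulate (g ∘ toℕ)) (fromℕ< j<n) ≡⟨ lookup∘tabulate (g ∘ toℕ) (fromℕ< j<n) ⟩
  g (toℕ (fromℕ< j<n))                     ≡⟨ cong g (toℕ-fromℕ< j<n) ⟩
  g j                                      ∎
  where open ≡-Reasoning

∈⇒lookupℕ : ∀ {n} {S : Subset n} {x} → x ∈ S → lookupℕ S (toℕ x) ≡ true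
∈⇒lookupℕ {S = S} x∈S = trans (lookupℕ-toℕ S _) ([]=⇒lookup x∈S)

lookupℕ⇒∈ : ∀ {n} {S : Subset n} {x} → lookupℕ S (toℕ x) ≡ true → x ∈ S
lookupℕ⇒∈ {S = S} {x} Sx = lookup⇒[]= x S (trans (sym (lookupℕ-toℕ S x)) Sx)

lookupℕ⇒Fin : ∀ {n} (S : Subset n) j → lookupℕ S j ≡ true → ∃ λ x → toℕ x ≡ j × x ∈ S
lookupℕ⇒Fin {n} S j Sj = fromℕ< j<n , toℕ-fromℕ< j<n , lookupℕ⇒∈ (trans (cong (lookupℕ S) (toℕ-fromℕ< j<n)) Sj)
  where j<n : j < n
        j<n = lookupℕ-true⇒< S Sj

extendℕ : ∀ {n} → (Fin n → ℕ) → ℕ → ℕ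
extendℕ {n} g j with j <? n
... | yes j<n = g (fromℕ< j<n)
... | no  _   = 0

extendℕ-toℕ : ∀ {n} (g : Fin n → ℕ) x → extendℕ g (toℕ x) ≡ g x
extendℕ-toℕ {n} g x with toℕ x <? n
... | yes x<n = cong g (fromℕ<-toℕ x x<n)
... | no  x≮n = ⊥-elim (x≮n (toℕ<n x))

Fin⇒0< : ∀ {k} → Fin k → 0 < k
Fin⇒0< i = >-nonZero⁻¹ _ ⦃ nonZeroIndex i ⦄

fromℕ-or-zero : ∀ {r} → 0 < r → ℕ → Fin r
fromℕ-or-zero {r} 0<r a with a <? r
... | yes a<r = fromℕ< a<r
... | no  _   = fromℕ< 0<r

toℕ-fromℕ-or-zero : ∀ {r} (0<r : 0 < r) {a} → a < r → toℕ (fromℕ-or-zero 0<r a) ≡ a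
toℕ-fromℕ-or-zero {r} 0<r {a} a<r with a <? r
... | yes _   = toℕ-fromℕ< a<r
... | no  a≮r = ⊥-elim (a≮r a<r)

prefixN-zero : ∀ {n} (v : Vec Bool n) → prefixN v 0 ≡ 0
prefixN-zero []      = refl
prefixN-zero (b ∷ v) = refl

prefixN-suc : ∀ {n} (v : Vec Bool n) k → prefixN v (suc k) ≡ bit (lookupℕ v k) + prefixN v k
prefixN-suc []      k       = refl
prefixN-suc (b ∷ v) zero    = cong (bit b +_) (prefixN-zero v)
prefixN-suc (b ∷ v) (suc k) = begin
  bit b + prefixN v (suc k)                     ≡⟨ cong (bit b +_) (prefixN-suc v k) ⟩
  bit b + (bit (lookupℕ v k) + prefixN v k)     ≡⟨ x∙yz≈y∙xz (bit b) (bit (lookupℕ v k)) (prefixN v k) ⟩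
  bit (lookupℕ v k) + (bit b + prefixN v k)     ∎
  where open ≡-Reasoning

prefixN-suc-true : ∀ {n} (v : Vec Bool n) {k} → lookupℕ v k ≡ true → prefixN v (suc k) ≡ suc (prefixN v k)
prefixN-suc-true v {k} vk = trans (prefixN-suc v k) (cong (λ b → bit b + prefixN v k) vk)

prefixN≤ : ∀ {n} (v : Vec Bool n) k → prefixN v k ≤ k
prefixN≤ v zero    = ≤-reflexive (prefixN-zero v)
prefixN≤ v (suc k) = begin
  prefixN v (suc k)               ≡⟨ prefixN-suc v k ⟩
  bit (lookupℕ v k) + prefixN v k ≤⟨ +-mono-≤ (bit≤1 _) (prefixN≤ v k) ⟩
  suc k                           ∎
  where open ≤-Reasoning

prefixN-⊓ : ∀ {n} (v : Vec Bool n) k → prefixN v k ≡ prefixN v (k ⊓ n)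
prefixN-⊓ []      k       = refl
prefixN-⊓ (b ∷ v) zero    = refl
prefixN-⊓ (b ∷ v) (suc k) = cong (bit b +_) (prefixN-⊓ v k)

prefixN-attains : ∀ {n} (v : Vec Bool n) w {t} → t < prefixN v w →
                  ∃ λ a → a < w × lookupℕ v a ≡ true × prefixN v a ≡ t
prefixN-attains v zero    {t} t<v0 = ⊥-elim (n≮0 (≤-trans t<v0 (≤-reflexive (prefixN-zero v))))
prefixN-attains v (suc w) {t} t<vw+1 with t <? prefixN v w | lookupℕ v w in vw
... | yes t<vw | _ = let a , a<w , va , va≡t = prefixN-attains v w t<vw in a , m≤n⇒m≤1+n a<w , va , va≡t
... | no t≮vw | true  =
  w , ≤-refl , vw , ≤-antisym (≮⇒≥ t≮vw) (≤-pred (≤-trans t<vw+1 (≤-reflexive (prefixN-suc-true v vw))))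
... | no t≮vw | false =
  ⊥-elim (t≮vw (≤-trans t<vw+1 (≤-reflexive (trans (prefixN-suc v w) (cong (λ b → bit b + prefixN v w) vw)))))

-- Staircase functions and the lattice paths they trace

stepwise-mono : ∀ {f : ℕ → ℕ} → (∀ k → f k ≤ f (suc k)) → ∀ {a b} → a ≤ b → f a ≤ f b
stepwise-mono     step {b = zero}  z≤n  = ≤-refl
stepwise-mono {f} step {b = suc b} a≤b+1 with m≤n⇒m<n∨m≡n a≤b+1
... | inj₁ a<b+1 = ≤-trans (stepwise-mono {f} step (≤-pred a<b+1)) (step b)
... | inj₂ refl  = ≤-refl

Staircase : (ℕ → ℕ) → Set
Staircase f = ∀ k → f k ≤ f (suc k) × f (suc k) ≤ suc (f k)

prefixN-staircase : ∀ {n} (v : Vec Bool n) → Staircase (prefixN v)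
prefixN-staircase v k rewrite prefixN-suc v k = m≤n+m _ _ , +-monoˡ-≤ _ (bit≤1 (lookupℕ v k))

staircase-mono : ∀ {f} → Staircase f → ∀ {a b} → a ≤ b → f a ≤ f b
staircase-mono {f} st = stepwise-mono {f} (proj₁ ∘ st)

staircase-<⇒< : ∀ {f} → Staircase f → ∀ {a b} → f a < f b → a < b
staircase-<⇒< st fa<fb = ≰⇒> (λ b≤a → <⇒≱ fa<fb (staircase-mono st b≤a))

staircase-⊔ : ∀ {f g} → Staircase f → Staircase g → Staircase (λ k → f k ⊔ g k)
staircase-⊔ sf sg k = ⊔-mono-≤ (proj₁ (sf k)) (proj₁ (sg k)) , ⊔-mono-≤ (proj₂ (sf k)) (proj₂ (sg k))

staircase-⊓ : ∀ {f g} → Staircase f → Staircase g → Staircase (λ k → f k ⊓ g k)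
staircase-⊓ sf sg k = ⊓-mono-≤ (proj₁ (sf k)) (proj₁ (sg k)) , ⊓-mono-≤ (proj₂ (sf k)) (proj₂ (sg k))

suc-∸-≤ : ∀ k c → suc k ∸ c ≤ suc (k ∸ c)
suc-∸-≤ k       zero    = ≤-refl
suc-∸-≤ zero    (suc c) = ≤-trans (≤-reflexive (0∸n≡0 c)) z≤n
suc-∸-≤ (suc k) (suc c) = suc-∸-≤ k c

staircase-∸ : ∀ c → Staircase (_∸ c)
staircase-∸ c k = ∸-monoˡ-≤ c (n≤1+n k) , suc-∸-≤ k c

staircase-const : ∀ c → Staircase (λ _ → c)
staircase-const c k = ≤-refl , n≤1+n c

bit-<ᵇ : ∀ {a b} → a ≤ b → b ≤ suc a → bit (a <ᵇ b) + a ≡ b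
bit-<ᵇ {a} {b} a≤b b≤a+1 with a <ᵇ b in a<ᵇb
... | true  = ≤-antisym (<ᵇ⇒< a b (Equivalence.from T-≡ a<ᵇb)) b≤a+1
... | false = ≤-antisym a≤b (≮⇒≥ λ a<b → subst T a<ᵇb (<⇒<ᵇ a<b))

staircasePath : ∀ n → (ℕ → ℕ) → Vec Bool n
staircasePath n f = tabulate (λ t → f (toℕ t) <ᵇ f (suc (toℕ t)))

prefixN-staircasePath : ∀ n {f} → Staircase f → ∀ k → prefixN (staircasePath n f) k + f 0 ≡ f (k ⊓ n)
prefixN-staircasePath zero    st k       rewrite ⊓-zeroʳ k = refl
prefixN-staircasePath (suc n) st zero    = refl
prefixN-staircasePath (suc n) {f} st (suc k) = begin
  b + X + f 0   ≡⟨ +-assoc b X (f 0) ⟩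
  b + (X + f 0) ≡⟨ x∙yz≈y∙xz b X (f 0) ⟩
  X + (b + f 0) ≡⟨ cong (X +_) (bit-<ᵇ (proj₁ (st 0)) (proj₂ (st 0))) ⟩
  X + f 1       ≡⟨ prefixN-staircasePath n (st ∘ suc) k ⟩
  f (suc (k ⊓ n)) ∎
  where
  open ≡-Reasoning
  b X : ℕ
  b = bit (f 0 <ᵇ f 1)
  X = prefixN (staircasePath n (f ∘ suc)) k

-- Counting members of a window, and pigeonhole

count : (ℕ → Bool) → ℕ → ℕ → ℕ
count T u zero    = 0
count T u (suc w) with u ≤? w
... | yes _ = bit (T w) + count T u w
... | no  _ = count T u w

count-suc : ∀ T {u w} → u ≤ w → count T u (suc w) ≡ bit (T w) + count T u w
count-suc T {u} {w} u≤w with u ≤? w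
... | yes _   = refl
... | no u≰w = ⊥-elim (u≰w u≤w)

count-empty : ∀ T {u} w → w ≤ u → count T u w ≡ 0
count-empty T zero    _   = refl
count-empty T {u} (suc w) w<u with u ≤? w
... | yes u≤w = ⊥-elim (<⇒≱ w<u u≤w)
... | no _    = count-empty T w (≤-trans (n≤1+n w) w<u)

count-single : ∀ T x → count T x (suc x) ≡ bit (T x)
count-single T x = trans (count-suc T ≤-refl) (trans (cong (bit (T x) +_) (count-empty T x ≤-refl)) (+-identityʳ _))

count-split : ∀ T {u v} w → u ≤ v → v ≤ w → count T u w ≡ count T u v + count T v w
count-split T zero    u≤v z≤n = refl
count-split T {u} {v} (suc w) u≤v v≤w+1 with m≤n⇒m<n∨m≡n v≤w+1
... | inj₂ refl = sym (trans (cong (count T u (suc w) +_) (count-empty T (suc w) ≤-refl)) (+-identityʳ _))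
... | inj₁ v<w+1 = begin
  count T u (suc w)                       ≡⟨ count-suc T (≤-trans u≤v v≤w) ⟩
  bit (T w) + count T u w                 ≡⟨ cong (bit (T w) +_) (count-split T w u≤v v≤w) ⟩
  bit (T w) + (count T u v + count T v w) ≡⟨ x∙yz≈y∙xz (bit (T w)) (count T u v) (count T v w) ⟩
  count T u v + (bit (T w) + count T v w) ≡⟨ cong (count T u v +_) (count-suc T v≤w) ⟨
  count T u v + count T v (suc w)         ∎
  where
  open ≡-Reasoning
  v≤w : v ≤ w
  v≤w = ≤-pred v<w+1

count-cong : ∀ {T T'} u w → (∀ {j} → u ≤ j → j < w → T j ≡ T' j) → count T u w ≡ count T' u w
count-cong u zero    _  = refl
count-cong u (suc w) eq with u ≤? w
... | yes u≤w = cong₂ _+_ (cong bit (eq u≤w ≤-refl)) (count-cong u w λ u≤j j<w → eq u≤j (m≤n⇒m≤1+n j<w))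
... | no  _   = count-cong u w λ u≤j j<w → eq u≤j (m≤n⇒m≤1+n j<w)

_∖_ : (ℕ → Bool) → ℕ → ℕ → Bool
(T ∖ c) j = if ⌊ j ≟ c ⌋ then false else T j

∖-≢ : ∀ T {c j} → j ≢ c → (T ∖ c) j ≡ T j
∖-≢ T {c} {j} j≢c with j ≟ c
... | yes j≡c = ⊥-elim (j≢c j≡c)
... | no  _   = refl

∖⇒ : ∀ T {c j} → (T ∖ c) j ≡ true → T j ≡ true × j ≢ c
∖⇒ T {c} {j} Tj with j ≟ c
... | no j≢c = Tj , j≢c

count-∖ : ∀ T {c} u w → c < u ⊎ w ≤ c → count (T ∖ c) u w ≡ count T u w
count-∖ T {c} u w outside = count-cong u w λ u≤j j<w → ∖-≢ T (λ j≡c → avoid outside u≤j j<w j≡c)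
  where avoid : ∀ {j} → c < u ⊎ w ≤ c → u ≤ j → j < w → j ≢ c
        avoid (inj₁ c<u) u≤j _   refl = <⇒≱ c<u u≤j
        avoid (inj₂ w≤c) _   j<w refl = <⇒≱ j<w w≤c

punchOutℕ : ℕ → ℕ → ℕ
punchOutℕ zero    a       = pred a
punchOutℕ (suc l) zero    = zero
punchOutℕ (suc l) (suc a) = suc (punchOutℕ l a)

punchOutℕ-injective : ∀ l {a b} → a ≢ l → b ≢ l → punchOutℕ l a ≡ punchOutℕ l b → a ≡ b
punchOutℕ-injective zero    {zero}  a≢l _   _ = ⊥-elim (a≢l refl)
punchOutℕ-injective zero    {suc a} {zero}  _ b≢l _ = ⊥-elim (b≢l refl)
punchOutℕ-injective zero    {suc a} {suc b} _ _ e = cong suc e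
punchOutℕ-injective (suc l) {zero}  {zero}  _ _ _ = refl
punchOutℕ-injective (suc l) {suc a} {suc b} a≢l b≢l e =
  cong suc (punchOutℕ-injective l (a≢l ∘ cong suc) (b≢l ∘ cong suc) (suc-injective e))

punchOutℕ-≥ : ∀ {lo l a} → lo ≤ l → lo ≤ a → a ≢ l → lo ≤ punchOutℕ l a
punchOutℕ-≥ {l = zero}  z≤n _ _ = z≤n
punchOutℕ-≥ {l = suc l} {zero} z≤n _ _ = z≤n
punchOutℕ-≥ {zero}  {suc l} {suc a} _ _ _ = z≤n
punchOutℕ-≥ {suc lo} {suc l} {suc a} (s≤s lo≤l) (s≤s lo≤a) a≢l = s≤s (punchOutℕ-≥ lo≤l lo≤a (a≢l ∘ cong suc))

punchOutℕ-< : ∀ {h l a} → l ≤ h → a ≤ h → a ≢ l → punchOutℕ l a < h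
punchOutℕ-< {l = zero}  {zero}  _ _ a≢l = ⊥-elim (a≢l refl)
punchOutℕ-< {l = zero}  {suc a} _ a<h _ = a<h
punchOutℕ-< {l = suc l} {zero}  l<h _ _ = ≤-trans (s≤s z≤n) l<h
punchOutℕ-< {suc h} {suc l} {suc a} (s≤s l≤h) (s≤s a≤h) a≢l = s≤s (punchOutℕ-< l≤h a≤h (a≢l ∘ cong suc))

InjectiveOn : (ℕ → Set) → (ℕ → ℕ) → Set
InjectiveOn A f = ∀ {j j'} → A j → A j' → f j ≡ f j' → j ≡ j'

increasing⇒injectiveOn : ∀ {A : ℕ → Set} {f} → (∀ {j j'} → A j → A j' → j < j' → f j < f j') → InjectiveOn A f
increasing⇒injectiveOn increasing {j} {j'} a a' e with <-cmp j j'
... | tri< j<j' _ _ = ⊥-elim (<⇒≢ (increasing a a' j<j') e)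
... | tri≈ _ j≡j' _ = j≡j'
... | tri> _ _ j'<j = ⊥-elim (<⇒≢ (increasing a' a j'<j) (sym e))

record Window (T : ℕ → Bool) (u w j : ℕ) : Set where
  constructor window
  field
    lower  : u ≤ j
    upper  : j < w
    member : T j ≡ true

Window-weaken : ∀ {T u w j} → Window T u w j → Window T u (suc w) j
Window-weaken (window u≤j j<w Tj) = window u≤j (m≤n⇒m≤1+n j<w) Tj

-- Punching out the value of the last member leaves an injection into a range one shorter.
count-bound : ∀ {T u} w {lo hi} (f : ℕ → ℕ) → lo ≤ hi →
              (∀ {j} → Window T u w j → lo ≤ f j × f j < hi) →
              InjectiveOn (Window T u w) f → lo + count T u w ≤ hi
count-bound zero    {lo} f lo≤hi _ _ = ≤-trans (≤-reflexive (+-identityʳ lo)) lo≤hi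
count-bound {T} {u} (suc w) {lo} f lo≤hi into inj with u ≤? w
... | no _    = count-bound w f lo≤hi (into ∘ Window-weaken) (λ p q → inj (Window-weaken p) (Window-weaken q))
... | yes u≤w with T w in Tw
...   | false = count-bound w f lo≤hi (into ∘ Window-weaken) (λ p q → inj (Window-weaken p) (Window-weaken q))
...   | true  with into (window u≤w ≤-refl Tw)
...     | lo≤l , s≤s l≤h = begin
  lo + suc (count T u w) ≡⟨ +-suc lo _ ⟩
  suc (lo + count T u w) ≤⟨ s≤s (count-bound w (punchOutℕ l ∘ f) (≤-trans lo≤l l≤h) into′ inj′) ⟩
  suc _                  ∎
  where
  open ≤-Reasoning
  l : ℕ
  l = f w
  avoids : ∀ {j} → Window T u w j → f j ≢ l
  avoids p e = <-irrefl (inj (Window-weaken p) (window u≤w ≤-refl Tw) e) (Window.upper p)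
  into′ : ∀ {j} → Window T u w j → lo ≤ punchOutℕ l (f j) × punchOutℕ l (f j) < _
  into′ p = let lo≤fj , fj<hi = into (Window-weaken p) in
            punchOutℕ-≥ lo≤l lo≤fj (avoids p) , punchOutℕ-< l≤h (≤-pred fj<hi) (avoids p)
  inj′ : InjectiveOn (Window T u w) (punchOutℕ l ∘ f)
  inj′ p q e = inj (Window-weaken p) (Window-weaken q) (punchOutℕ-injective l (avoids p) (avoids q) e)

-- Greedy matching

-- Scanning left to right, each j with T j takes the least index that is ≥ p j and above all
-- indices taken so far; greedy p T j is one more than the last index taken before j.
greedy : (ℕ → ℕ) → (ℕ → Bool) → ℕ → ℕ
greedy p T zero    = 0
greedy p T (suc j) = if T j then suc (greedy p T j ⊔ p j) else greedy p T j

greedy-step : ∀ p T j → greedy p T j ≤ greedy p T (suc j)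
greedy-step p T j with T j
... | true  = ≤-trans (m≤m⊔n _ _) (n≤1+n _)
... | false = ≤-refl

greedy-last-reset : ∀ p T j → greedy p T j ≡ 0 ⊎ ∃ λ s → s < j × T s ≡ true × greedy p T j ≡ p s + count T s j
greedy-last-reset p T zero = inj₁ refl
greedy-last-reset p T (suc j) with T j in Tj | greedy-last-reset p T j
... | false | inj₁ g≡0 = inj₁ g≡0
... | false | inj₂ (s , s<j , Ts , g≡) = inj₂ (s , m≤n⇒m≤1+n s<j , Ts , trans g≡ (cong (p s +_) (sym count≡)))
  where count≡ : count T s (suc j) ≡ count T s j
        count≡ = trans (count-suc T (<⇒≤ s<j)) (cong (λ b → bit b + count T s j) Tj)
... | true | reset with greedy p T j ≤? p j
...   | yes g≤pj = inj₂ (j , ≤-refl , Tj , (begin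
  suc (greedy p T j ⊔ p j) ≡⟨ cong suc (m≤n⇒m⊔n≡n g≤pj) ⟩
  suc (p j)                ≡⟨ +-comm 1 (p j) ⟩
  p j + 1                  ≡⟨ cong (p j +_) (trans (count-single T j) (cong bit Tj)) ⟨
  p j + count T j (suc j)  ∎))
  where open ≡-Reasoning
greedy-last-reset p T (suc j) | true | inj₁ g≡0 | no g≰pj = ⊥-elim (g≰pj (≤-trans (≤-reflexive g≡0) z≤n))
greedy-last-reset p T (suc j) | true | inj₂ (s , s<j , Ts , g≡) | no g≰pj = inj₂ (s , m≤n⇒m≤1+n s<j , Ts , (begin
  suc (greedy p T j ⊔ p j)       ≡⟨ cong suc (m≥n⇒m⊔n≡m (<⇒≤ (≰⇒> g≰pj))) ⟩
  suc (greedy p T j)             ≡⟨ cong suc g≡ ⟩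
  suc (p s + count T s j)        ≡⟨ +-suc (p s) _ ⟨
  p s + suc (count T s j)        ≡⟨ cong (p s +_) (trans (count-suc T (<⇒≤ s<j)) (cong (λ b → bit b + count T s j) Tj)) ⟨
  p s + count T s (suc j)        ∎))
  where open ≡-Reasoning

greedy-suc-true : ∀ p T {j} → T j ≡ true → greedy p T (suc j) ≡ suc (greedy p T j ⊔ p j)
greedy-suc-true p T Tj rewrite Tj = refl

greedy-bound : ∀ p T {j} → T j ≡ true → ∃ λ s → s ≤ j × T s ≡ true × greedy p T j ⊔ p j < p s + count T s (suc j)
greedy-bound p T {j} Tj with greedy-last-reset p T (suc j)
... | inj₁ g≡0 = ⊥-elim (1+n≢0 (trans (sym (greedy-suc-true p T Tj)) g≡0))
... | inj₂ (s , s<j+1 , Ts , g≡) = s , ≤-pred s<j+1 , Ts , ≤-reflexive (trans (sym (greedy-suc-true p T Tj)) g≡)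

greedy-< : ∀ p T {j j'} → T j ≡ true → j < j' → greedy p T j ⊔ p j < greedy p T j' ⊔ p j'
greedy-< p T {j} {j'} Tj j<j' = begin-strict
  greedy p T j ⊔ p j       <⟨ n<1+n _ ⟩
  suc (greedy p T j ⊔ p j) ≡⟨ greedy-suc-true p T Tj ⟨
  greedy p T (suc j)       ≤⟨ stepwise-mono {greedy p T} (greedy-step p T) j<j' ⟩
  greedy p T j'            ≤⟨ m≤m⊔n _ _ ⟩
  greedy p T j' ⊔ p j'     ∎
  where open ≤-Reasoning

module LatticePathMatroid (m r : ℕ) (P Q : Vec Bool (m + r))
                          (pathP : IsPath m r P) (pathQ : IsPath m r Q) (P≤Q : Below P Q) where

  n : ℕ
  n = m + r

  hP hQ : ℕ → ℕ
  hP = prefixN P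
  hQ = prefixN Q

  hQ≤r : ∀ k → hQ k ≤ r
  hQ≤r k = begin
    hQ k       ≡⟨ prefixN-⊓ Q k ⟩
    hQ (k ⊓ n) ≤⟨ staircase-mono (prefixN-staircase Q) (m⊓n≤n k n) ⟩
    hQ n       ≡⟨ pathQ ⟩
    r          ∎
    where open ≤-Reasoning

  hP≤r : ∀ k → hP k ≤ r
  hP≤r k = ≤-trans (P≤Q k) (hQ≤r k)

  InNℕ : ℕ → ℕ → Set
  InNℕ i j = hP j ≤ i × i < hQ (suc j)

  InNℕ⇒<r : ∀ {i j} → InNℕ i j → i < r
  InNℕ⇒<r {j = j} (_ , i<hQ) = ≤-trans i<hQ (hQ≤r (suc j))

  InN⇒InNℕ : ∀ {i j} → InN m r P Q i j → InNℕ (toℕ i) (toℕ j)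
  InN⇒InNℕ {i} {j} (R , (_ , P≤R , R≤Q) , Rj , hRj) =
    ≤-trans (P≤R (toℕ j)) (≤-reflexive hRj) ,
    ≤-trans (≤-reflexive (trans (cong suc (sym hRj)) (sym (prefixN-suc-true R (trans (lookupℕ-toℕ R j) Rj)))))
            (R≤Q (suc (toℕ j)))

  -- Between P and Q, follow the diagonal through (j, i) and stop at height i + 1.
  module PathThrough {i j : ℕ} (j<n : j < n) (i∈Nj : InNℕ i j) where
    hPj≤i : hP j ≤ i
    hPj≤i = proj₁ i∈Nj

    i<hQj+1 : i < hQ (suc j)
    i<hQj+1 = proj₂ i∈Nj

    i≤j : i ≤ j
    i≤j = ≤-pred (≤-trans i<hQj+1 (prefixN≤ Q (suc j)))

    i≤hQj : i ≤ hQ j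
    i≤hQj = ≤-pred (≤-trans i<hQj+1 (proj₂ (prefixN-staircase Q j)))

    f : ℕ → ℕ
    f k = hP k ⊔ (((k ∸ (j ∸ i)) ⊓ suc i) ⊓ hQ k)

    f-staircase : Staircase f
    f-staircase = staircase-⊔ (prefixN-staircase P)
                    (staircase-⊓ (staircase-⊓ (staircase-∸ (j ∸ i)) (staircase-const (suc i))) (prefixN-staircase Q))

    R : Vec Bool n
    R = staircasePath n f

    hR : ∀ k → prefixN R k ≡ f (k ⊓ n)
    hR k = begin
      prefixN R k         ≡⟨ +-identityʳ _ ⟨
      prefixN R k + 0     ≡⟨ cong (prefixN R k +_) f0≡0 ⟨
      prefixN R k + f 0   ≡⟨ prefixN-staircasePath n f-staircase k ⟩
      f (k ⊓ n)           ∎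
      where open ≡-Reasoning
            f0≡0 : f 0 ≡ 0
            f0≡0 rewrite prefixN-zero P | prefixN-zero Q | 0∸n≡0 (j ∸ i) = refl

    f≤hQ : ∀ k → f k ≤ hQ k
    f≤hQ k = ⊔-lub (P≤Q k) (m⊓n≤n _ _)

    R-path : IsPath m r R
    R-path = begin-equality
      prefixN R n ≡⟨ hR n ⟩
      f (n ⊓ n)   ≡⟨ cong f (⊓-idem n) ⟩
      f n         ≡⟨ ≤-antisym (≤-trans (f≤hQ n) (≤-reflexive pathQ))
                               (≤-trans (≤-reflexive (sym pathP)) (m≤m⊔n _ _)) ⟩
      r           ∎
      where open ≤-Reasoning

    P≤R : Below P R
    P≤R k rewrite hR k | prefixN-⊓ P k = m≤m⊔n _ _

    R≤Q : Below R Q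
    R≤Q k rewrite hR k | prefixN-⊓ Q k = f≤hQ (k ⊓ n)

    fj≡i : f j ≡ i
    fj≡i rewrite m∸[m∸n]≡n i≤j | m≤n⇒m⊓n≡m (n≤1+n i) | m≤n⇒m⊓n≡m i≤hQj = m≤n⇒m⊔n≡n hPj≤i

    fj+1≡i+1 : f (suc j) ≡ suc i
    fj+1≡i+1 rewrite +-∸-assoc 1 (m∸n≤m j i) | m∸[m∸n]≡n i≤j | ⊓-idem (suc i) | m≤n⇒m⊓n≡m i<hQj+1 =
      m≤n⇒m⊔n≡n (≤-trans (proj₂ (prefixN-staircase P j)) (s≤s hPj≤i))

    R-north : lookupℕ R j ≡ true
    R-north rewrite lookupℕ-tabulate (λ t → f t <ᵇ f (suc t)) j<n | fj≡i | fj+1≡i+1 = Equivalence.to T-≡ (<⇒<ᵇ (n<1+n i))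

    hRj≡i : prefixN R j ≡ i
    hRj≡i rewrite hR j | m≤n⇒m⊓n≡m (<⇒≤ j<n) = fj≡i

  InNℕ⇒InN : ∀ i j → InNℕ (toℕ i) (toℕ j) → InN m r P Q i j
  InNℕ⇒InN i j i∈Nj = R , (R-path , P≤R , R≤Q) , trans (sym (lookupℕ-toℕ R j)) R-north , hRj≡i
    where open PathThrough (toℕ<n j) i∈Nj

  -- Partial transversals and Hall's condition

  record PartialTransversal (T : ℕ → Bool) : Set where
    field
      index           : ℕ → ℕ
      index-fits      : ∀ {j} → T j ≡ true → InNℕ (index j) j
      index-injective : InjectiveOn (λ j → T j ≡ true) index

  partialTransversal-⊆ : ∀ {T T'} → (∀ {j} → T' j ≡ true → T j ≡ true) → PartialTransversal T → PartialTransversal T'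
  partialTransversal-⊆ T'⊆T M = record
    { index           = index
    ; index-fits      = index-fits ∘ T'⊆T
    ; index-injective = λ a b → index-injective (T'⊆T a) (T'⊆T b)
    }
    where open PartialTransversal M

  independent⇒partialTransversal : ∀ {S} → Independent m r P Q S → PartialTransversal (lookupℕ S)
  independent⇒partialTransversal {S} (φ , φ-fits , φ-injective) = record
    { index           = index
    ; index-fits      = fits
    ; index-injective = injective
    }
    where
    index : ℕ → ℕ
    index = extendℕ (toℕ ∘ φ)
    fits : ∀ {j} → lookupℕ S j ≡ true → InNℕ (index j) j
    fits {j} Sj with lookupℕ⇒Fin S j Sj
    ... | x , refl , x∈S rewrite extendℕ-toℕ (toℕ ∘ φ) x = InN⇒InNℕ (φ-fits x x∈S)
    injective : InjectiveOn (λ j → lookupℕ S j ≡ true) index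
    injective {j} {j'} Sj Sj' e with lookupℕ⇒Fin S j Sj | lookupℕ⇒Fin S j' Sj'
    ... | x , refl , x∈S | y , refl , y∈S rewrite extendℕ-toℕ (toℕ ∘ φ) x | extendℕ-toℕ (toℕ ∘ φ) y =
      cong toℕ (φ-injective x y x∈S y∈S (toℕ-injective e))

  partialTransversal⇒independent : ∀ {S} → 0 < r → PartialTransversal (lookupℕ S) → Independent m r P Q S
  partialTransversal⇒independent {S} 0<r M = φ , φ-fits , φ-injective
    where
    open PartialTransversal M
    φ : Fin n → Fin r
    φ x = fromℕ-or-zero 0<r (index (toℕ x))
    toℕ-φ : ∀ {x} → x ∈ S → toℕ (φ x) ≡ index (toℕ x)
    toℕ-φ x∈S = toℕ-fromℕ-or-zero 0<r (InNℕ⇒<r (index-fits (∈⇒lookupℕ x∈S)))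
    φ-fits : ∀ x → x ∈ S → InN m r P Q (φ x) x
    φ-fits x x∈S = InNℕ⇒InN (φ x) x (subst (λ i → InNℕ i (toℕ x)) (sym (toℕ-φ x∈S)) (index-fits (∈⇒lookupℕ x∈S)))
    φ-injective : ∀ x y → x ∈ S → y ∈ S → φ x ≡ φ y → x ≡ y
    φ-injective x y x∈S y∈S e = toℕ-injective (index-injective (∈⇒lookupℕ x∈S) (∈⇒lookupℕ y∈S)
                                  (trans (sym (toℕ-φ x∈S)) (trans (cong toℕ e) (toℕ-φ y∈S))))

  partialTransversal⇒hall : ∀ {T} → PartialTransversal T → ∀ {u v} → u ≤ v → hP u + count T u (suc v) ≤ hQ (suc v)
  partialTransversal⇒hall {T} M {u} {v} u≤v =
    count-bound (suc v) index (≤-trans (P≤Q u) (hQ-mono (m≤n⇒m≤1+n u≤v))) into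
                (λ a b → index-injective (Window.member a) (Window.member b))
    where
    open PartialTransversal M
    hQ-mono : ∀ {a b} → a ≤ b → hQ a ≤ hQ b
    hQ-mono = staircase-mono (prefixN-staircase Q)
    into : ∀ {j} → Window T u (suc v) j → hP u ≤ index j × index j < hQ (suc v)
    into (window u≤j j<v+1 Tj) = ≤-trans (staircase-mono (prefixN-staircase P) u≤j) (proj₁ (index-fits Tj)) ,
                                 ≤-trans (proj₂ (index-fits Tj)) (hQ-mono j<v+1)

  greedyIndex : (ℕ → Bool) → ℕ → ℕ
  greedyIndex T j = greedy hP T j ⊔ hP j

  greedy-partialTransversal : ∀ {T} → (∀ {j} → T j ≡ true → greedyIndex T j < hQ (suc j)) → PartialTransversal T
  greedy-partialTransversal {T} fits = record
    { index           = greedyIndex T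
    ; index-fits      = λ Tj → m≤n⊔m _ _ , fits Tj
    ; index-injective = increasing⇒injectiveOn (λ Tj _ → greedy-< hP T Tj)
    }

  record HallViolation (T : ℕ → Bool) : Set where
    field
      first last : ℕ
      first≤last : first ≤ last
      first∈     : T first ≡ true
      last∈      : T last ≡ true
      overfull   : hQ (suc last) < hP first + count T first (suc last)

  hall-violation : ∀ {T} w → (∀ {j} → T j ≡ true → j < w) → ¬ PartialTransversal T → HallViolation T
  hall-violation {T} w bounded ¬M with anyUpTo? (λ j → (T j Boolₚ.≟ true) ×-dec (hQ (suc j) ≤? greedyIndex T j)) w
  ... | no ¬overfull =
    ⊥-elim (¬M (greedy-partialTransversal λ {j} Tj → ≰⇒> λ hQ≤ → ¬overfull (j , bounded Tj , Tj , hQ≤)))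
  ... | yes (j , _ , Tj , hQ≤) = let s , s≤j , Ts , index< = greedy-bound hP T Tj in record
    { first      = s
    ; last       = j
    ; first≤last = s≤j
    ; first∈     = Ts
    ; last∈      = Tj
    ; overfull   = ≤-<-trans hQ≤ index<
    }

  circuit-deletion : ∀ {C} → Circuit m r P Q C → ∀ {c} → lookupℕ C c ≡ true → PartialTransversal (lookupℕ C ∖ c)
  circuit-deletion {C} (_ , minimal) {c} Cc with lookupℕ⇒Fin C c Cc
  ... | x , refl , x∈C = partialTransversal-⊆ into (independent⇒partialTransversal (minimal (C - x) (x∈p⇒p-x⊂p x∈C)))
    where
    into : ∀ {j} → (lookupℕ C ∖ toℕ x) j ≡ true → lookupℕ (C - x) j ≡ true
    into {j} C∖xj with ∖⇒ (lookupℕ C) C∖xj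
    ... | Cj , j≢x with lookupℕ⇒Fin C j Cj
    ...   | y , refl , y∈C = ∈⇒lookupℕ (x∈p∧x≢y⇒x∈p-y y∈C (j≢x ∘ cong toℕ))

  independent-insert : ∀ {B} ((φ , _) : Independent m r P Q B) {z i} → z ∉ B → InN m r P Q i z →
                       (∀ y → y ∈ B → φ y ≢ i) → Independent m r P Q (⁅ z ⁆ ∪ B)
  independent-insert {B} (φ , φ-fits , φ-injective) {z} {i} z∉B z∈Ni fresh = ψ , ψ-fits , ψ-injective
    where
    ψ : Fin n → Fin r
    ψ y with y Finₚ.≟ z
    ... | yes _ = i
    ... | no  _ = φ y
    in-B : ∀ {y} → y ∈ ⁅ z ⁆ ∪ B → y ≢ z → y ∈ B
    in-B {y} y∈ y≢z with x∈p∪q⁻ ⁅ z ⁆ B y∈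
    ... | inj₁ y∈⁅z⁆ = ⊥-elim (y≢z (x∈⁅y⁆⇒x≡y z y∈⁅z⁆))
    ... | inj₂ y∈B   = y∈B
    ψ-fits : ∀ y → y ∈ ⁅ z ⁆ ∪ B → InN m r P Q (ψ y) y
    ψ-fits y y∈ with y Finₚ.≟ z
    ... | yes refl = z∈Ni
    ... | no  y≢z  = φ-fits y (in-B y∈ y≢z)
    ψ-injective : ∀ y y' → y ∈ ⁅ z ⁆ ∪ B → y' ∈ ⁅ z ⁆ ∪ B → ψ y ≡ ψ y' → y ≡ y'
    ψ-injective y y' y∈ y'∈ e with y Finₚ.≟ z | y' Finₚ.≟ z
    ... | yes y≡z | yes y'≡z = trans y≡z (sym y'≡z)
    ... | yes _   | no y'≢z  = ⊥-elim (fresh y' (in-B y'∈ y'≢z) (sym e))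
    ... | no y≢z  | yes _    = ⊥-elim (fresh y (in-B y∈ y≢z) e)
    ... | no y≢z  | no y'≢z  = φ-injective y y' (in-B y∈ y≢z) (in-B y'∈ y'≢z) e

  r+1-elements⇒dependent : ∀ {S} (e : Fin (suc r) → Fin n) → (∀ t → e t ∈ S) →
                           (∀ {t t'} → e t ≡ e t' → t ≡ t') → ¬ Independent m r P Q S
  r+1-elements⇒dependent e e∈S e-injective (φ , _ , φ-injective) with pigeonhole (n<1+n r) (φ ∘ e)
  ... | t , t' , t<t' , φet≡φet' = Finₚ.<-irrefl (e-injective (φ-injective (e t) (e t') (e∈S t) (e∈S t') φet≡φet')) t<t'

  -- Elements of spanning circuits

  InTwoN InFirstN InLastN InTwoOrExtremeN : Fin n → Set
  InTwoN x = Σ (Fin r) λ i → Σ (Fin r) λ j → ¬ (i ≡ j) × InN m r P Q i x × InN m r P Q j x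
  InFirstN x = Σ (Fin r) λ i → toℕ i ≡ 0 × InN m r P Q i x
  InLastN x = Σ (Fin r) λ i → suc (toℕ i) ≡ r × InN m r P Q i x
  InTwoOrExtremeN x = InTwoN x ⊎ (InFirstN x ⊎ InLastN x)

  InNℕ⇒InN-fromℕ< : ∀ {a x} (a∈ : InNℕ a (toℕ x)) → InN m r P Q (fromℕ< (InNℕ⇒<r a∈)) x
  InNℕ⇒InN-fromℕ< {a} {x} a∈ =
    InNℕ⇒InN _ x (subst (λ i → InNℕ i (toℕ x)) (sym (toℕ-fromℕ< (InNℕ⇒<r a∈))) a∈)

  inTwoN : ∀ {a b x} → a < b → InNℕ a (toℕ x) → InNℕ b (toℕ x) → InTwoN x
  inTwoN a<b a∈ b∈ = _ , _ , a≢b , InNℕ⇒InN-fromℕ< a∈ , InNℕ⇒InN-fromℕ< b∈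
    where a≢b : fromℕ< (InNℕ⇒<r a∈) ≢ fromℕ< (InNℕ⇒<r b∈)
          a≢b e = <⇒≢ a<b (trans (sym (toℕ-fromℕ< (InNℕ⇒<r a∈))) (trans (cong toℕ e) (toℕ-fromℕ< (InNℕ⇒<r b∈))))

  inFirstN : ∀ {x} → InNℕ 0 (toℕ x) → InFirstN x
  inFirstN 0∈ = _ , toℕ-fromℕ< (InNℕ⇒<r 0∈) , InNℕ⇒InN-fromℕ< 0∈

  inLastN : ∀ {a x} → suc a ≡ r → InNℕ a (toℕ x) → InLastN x
  inLastN a+1≡r a∈ = _ , trans (cong suc (toℕ-fromℕ< (InNℕ⇒<r a∈))) a+1≡r , InNℕ⇒InN-fromℕ< a∈

  module SpanningCircuitMember {C : Subset n} (C-circuit : Circuit m r P Q C) (C-spanning : Spanning m r P Q C)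
                               {x : Fin n} (x∈C : x ∈ C) (violation : HallViolation (lookupℕ C)) where

    inC : ℕ → Bool
    inC = lookupℕ C

    B : Subset n
    B = proj₁ C-spanning

    B⊆C : B ⊆ C
    B⊆C = proj₁ (proj₂ C-spanning)

    B-independent : Independent m r P Q B
    B-independent = proj₁ (proj₂ (proj₂ C-spanning))

    B-maximal : ∀ y → y ∉ B → ¬ Independent m r P Q (⁅ y ⁆ ∪ B)
    B-maximal = proj₂ (proj₂ (proj₂ C-spanning))

    φ : Fin n → Fin r
    φ = proj₁ B-independent

    0<r : 0 < r
    0<r = Fin⇒0< (φ x)

    r-1 : ℕ
    r-1 = pred r

    r-1+1≡r : suc r-1 ≡ r
    r-1+1≡r = suc-pred r ⦃ >-nonZero 0<r ⦄

    open HallViolation violation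

    hall-without : ∀ {c} → inC c ≡ true → ∀ {u v} → u ≤ v → c < u ⊎ suc v ≤ c →
                   hP u + count inC u (suc v) ≤ hQ (suc v)
    hall-without {c} Cc {u} {v} u≤v outside =
      subst (λ k → hP u + k ≤ hQ (suc v)) (count-∖ inC u (suc v) outside)
            (partialTransversal⇒hall (circuit-deletion C-circuit Cc) u≤v)

    -- Deleting a member outside the violating window would leave the violation intact.
    within : ∀ {c} → inC c ≡ true → first ≤ c × c ≤ last
    within {c} Cc with first ≤? c | c ≤? last
    ... | yes first≤c | yes c≤last = first≤c , c≤last
    ... | no first≰c  | _          = ⊥-elim (<⇒≱ overfull (hall-without Cc first≤last (inj₁ (≰⇒> first≰c))))
    ... | yes _       | no c≰last  = ⊥-elim (<⇒≱ overfull (hall-without Cc first≤last (inj₂ (≰⇒> c≰last))))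

    within-B : ∀ {y} → y ∈ B → first ≤ toℕ y × toℕ y ≤ last
    within-B y∈B = within (∈⇒lookupℕ (B⊆C y∈B))

    -- Otherwise the first North step of Q precedes the window and extends B with index 0.
    hP-first≡0 : hP first ≡ 0
    hP-first≡0 with hP first in hPs
    ... | zero  = refl
    ... | suc _ with prefixN-attains Q first (≤-trans (s≤s z≤n) (≤-trans (≤-reflexive (sym hPs)) (P≤Q first)))
    ...   | z , z<first , Qz , hQz≡0 = ⊥-elim (B-maximal z′ z∉B (independent-insert B-independent z∉B z∈N₀ fresh))
      where
      z<n : z < n
      z<n = ≤-<-trans (≤-trans (<⇒≤ z<first) first≤last) (lookupℕ-true⇒< C last∈)
      z′ : Fin n
      z′ = fromℕ< z<n
      z∉B : z′ ∉ B
      z∉B z∈B = <⇒≱ z<first (≤-trans (proj₁ (within-B z∈B)) (≤-reflexive (toℕ-fromℕ< z<n)))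
      z∈N₀ : InN m r P Q (fromℕ< 0<r) z′
      z∈N₀ = InNℕ⇒InN _ z′ (subst₂ InNℕ (sym (toℕ-fromℕ< 0<r)) (sym (toℕ-fromℕ< z<n))
               (≤-trans (P≤Q z) (≤-reflexive hQz≡0) , ≤-trans (s≤s z≤n) (≤-reflexive (sym (prefixN-suc-true Q Qz)))))
      fresh : ∀ y → y ∈ B → φ y ≢ fromℕ< 0<r
      fresh y y∈B φy≡0 = 1+n≰n (begin
        1                ≤⟨ s≤s z≤n ⟩
        suc _            ≡⟨ hPs ⟨
        hP first         ≤⟨ staircase-mono (prefixN-staircase P) (proj₁ (within-B y∈B)) ⟩
        hP (toℕ y)       ≤⟨ proj₁ (InN⇒InNℕ (proj₁ (proj₂ B-independent) y y∈B)) ⟩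
        toℕ (φ y)        ≡⟨ cong toℕ φy≡0 ⟩
        toℕ (fromℕ< 0<r) ≡⟨ toℕ-fromℕ< 0<r ⟩
        0                ∎)
        where open ≤-Reasoning

    -- Otherwise the last North step of P follows the window and extends B with index r − 1.
    hQ-last≡r : hQ (suc last) ≡ r
    hQ-last≡r with hQ (suc last) <? r
    ... | no  hQ≮r = ≤-antisym (hQ≤r _) (≮⇒≥ hQ≮r)
    ... | yes hQ<r with prefixN-attains P n (≤-trans (≤-reflexive r-1+1≡r) (≤-reflexive (sym pathP)))
    ...   | z , z<n , Pz , hPz≡r-1 = ⊥-elim (B-maximal z′ z∉B (independent-insert B-independent z∉B z∈Nr-1 fresh))
      where
      hPz+1≡r : hP (suc z) ≡ r
      hPz+1≡r = trans (prefixN-suc-true P Pz) (trans (cong suc hPz≡r-1) r-1+1≡r)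
      last<z : last < z
      last<z = ≤-pred (staircase-<⇒< (prefixN-staircase P)
                 (≤-<-trans (P≤Q (suc last)) (<-≤-trans hQ<r (≤-reflexive (sym hPz+1≡r)))))
      z′ : Fin n
      z′ = fromℕ< z<n
      i : Fin r
      i = fromℕ< (≤-reflexive r-1+1≡r)
      z∉B : z′ ∉ B
      z∉B z∈B = <⇒≱ last<z (≤-trans (≤-reflexive (sym (toℕ-fromℕ< z<n))) (proj₂ (within-B z∈B)))
      z∈Nr-1 : InN m r P Q i z′
      z∈Nr-1 = InNℕ⇒InN _ z′ (subst₂ InNℕ (sym (toℕ-fromℕ< _)) (sym (toℕ-fromℕ< z<n))
                 (≤-reflexive hPz≡r-1 , ≤-trans (≤-reflexive r-1+1≡r) (≤-trans (≤-reflexive (sym hPz+1≡r)) (P≤Q (suc z)))))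
      fresh : ∀ y → y ∈ B → φ y ≢ i
      fresh y y∈B φy≡i = <-irrefl (trans (cong toℕ φy≡i) (toℕ-fromℕ< _)) (≤-pred (begin-strict
        suc (toℕ (φ y))    ≤⟨ proj₂ (InN⇒InNℕ (proj₁ (proj₂ B-independent) y y∈B)) ⟩
        hQ (suc (toℕ y))   ≤⟨ staircase-mono (prefixN-staircase Q) (s≤s (proj₂ (within-B y∈B))) ⟩
        hQ (suc last)      <⟨ hQ<r ⟩
        r                  ≡⟨ r-1+1≡r ⟨
        suc r-1            ∎))
        where open ≤-Reasoning

    x′ : ℕ
    x′ = toℕ x

    first≤x : first ≤ x′
    first≤x = proj₁ (within (∈⇒lookupℕ x∈C))

    x≤last : x′ ≤ last
    x≤last = proj₂ (within (∈⇒lookupℕ x∈C))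

    before after : ℕ
    before = count inC first x′
    after  = count inC (suc x′) (suc last)

    count-x : count inC x′ (suc x′) ≡ 1
    count-x = trans (count-single inC x′) (cong bit (∈⇒lookupℕ x∈C))

    count-up-to-x : count inC first (suc x′) ≡ before + 1
    count-up-to-x = trans (count-split inC (suc x′) first≤x (n≤1+n x′)) (cong (before +_) count-x)

    count-from-x : count inC x′ (suc last) ≡ suc after
    count-from-x = trans (count-split inC (suc last) (n≤1+n x′) (s≤s x≤last)) (cong (_+ after) count-x)

    r≤before+after : r ≤ before + after
    r≤before+after = ≤-pred (begin-strict
      r                                   ≡⟨ hQ-last≡r ⟨
      hQ (suc last)                       <⟨ overfull ⟩
      hP first + count inC first (suc last)
        ≡⟨ cong₂ _+_ hP-first≡0 (count-split inC (suc last) first≤x (≤-trans x≤last (n≤1+n last))) ⟩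
      before + count inC x′ (suc last)    ≡⟨ cong (before +_) count-from-x ⟩
      before + suc after                  ≡⟨ +-suc before after ⟩
      suc (before + after)                ∎)
      where open ≤-Reasoning

    before<hQ : x′ < last → before < hQ (suc x′)
    before<hQ x<last = begin-strict
      before                         <⟨ n<1+n before ⟩
      suc before                     ≡⟨ +-comm 1 before ⟩
      before + 1                     ≡⟨ cong₂ _+_ hP-first≡0 count-up-to-x ⟨
      hP first + count inC first (suc x′) ≤⟨ hall-without last∈ first≤x (inj₂ x<last) ⟩
      hQ (suc x′)                    ∎
      where open ≤-Reasoning

    hP+after<r : first < x′ → hP x′ + after < r
    hP+after<r first<x = begin-strict
      hP x′ + after                  <⟨ +-monoʳ-< (hP x′) (n<1+n after) ⟩
      hP x′ + suc after              ≡⟨ cong (hP x′ +_) count-from-x ⟨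
      hP x′ + count inC x′ (suc last) ≤⟨ hall-without first∈ x≤last (inj₁ first<x) ⟩
      hQ (suc last)                  ≡⟨ hQ-last≡r ⟩
      r                              ∎
      where open ≤-Reasoning

    inTwoOrExtremeN : InTwoOrExtremeN x
    inTwoOrExtremeN with first <? x′ | x′ <? last
    ... | no first≮x | yes x<last = inj₂ (inj₁ (inFirstN (hPx≤0 , ≤-<-trans z≤n (before<hQ x<last))))
      where hPx≤0 : hP x′ ≤ 0
            hPx≤0 = ≤-reflexive (trans (cong hP (sym (≤-antisym first≤x (≮⇒≥ first≮x)))) hP-first≡0)
    ... | no first≮x | no x≮last =
      ⊥-elim (<⇒≱ 0<r (≤-trans r≤before+after (≤-reflexive (cong₂ _+_ before≡0 after≡0))))
      where before≡0 : before ≡ 0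
            before≡0 = count-empty inC x′ (≮⇒≥ first≮x)
            after≡0 : after ≡ 0
            after≡0 = count-empty inC (suc last) (s≤s (≮⇒≥ x≮last))
    ... | yes first<x | no x≮last = inj₂ (inj₂ (inLastN r-1+1≡r (hPx≤r-1 , r-1<hQ)))
      where
      hPx≤r-1 : hP x′ ≤ r-1
      hPx≤r-1 = ≤-pred (≤-trans (s≤s (m≤m+n (hP x′) after)) (≤-trans (hP+after<r first<x) (≤-reflexive (sym r-1+1≡r))))
      r-1<hQ : r-1 < hQ (suc x′)
      r-1<hQ = ≤-reflexive (trans r-1+1≡r (sym (trans (cong (hQ ∘ suc) (≤-antisym x≤last (≮⇒≥ x≮last))) hQ-last≡r)))
    ... | yes first<x | yes x<last =
      inj₁ (inTwoN (n<1+n (hP x′)) (≤-refl , <-trans hPx<before (before<hQ x<last))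
                                   (n≤1+n _ , ≤-<-trans hPx<before (before<hQ x<last)))
      where
      hPx<before : hP x′ < before
      hPx<before = +-cancelʳ-< after (hP x′) before (<-≤-trans (hP+after<r first<x) r≤before+after)

  spanningCircuit⇒InTwoOrExtremeN : ∀ {C x} → SpanningCircuit m r P Q C → x ∈ C → InTwoOrExtremeN x
  spanningCircuit⇒InTwoOrExtremeN {C} {x} (C-circuit , C-spanning) x∈C =
    SpanningCircuitMember.inTwoOrExtremeN C-circuit C-spanning x∈C
      (hall-violation n (lookupℕ-true⇒< C) (proj₁ C-circuit ∘ partialTransversal⇒independent 0<r))
    where 0<r = Fin⇒0< (proj₁ (proj₁ (proj₂ (proj₂ C-spanning))) x)

  -- Spanning circuits through a given element

  partialTransversal-split : ∀ {T T₁ T₂ j} → hQ j ≤ hP j → PartialTransversal T₁ → PartialTransversal T₂ →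
                             (∀ {k} → T k ≡ true → k < j → T₁ k ≡ true) →
                             (∀ {k} → T k ≡ true → j ≤ k → T₂ k ≡ true) → PartialTransversal T
  partialTransversal-split {T} {j = j} hQ≤hP M₁ M₂ T₁⊇ T₂⊇ = record
    { index           = index
    ; index-fits      = fits
    ; index-injective = injective
    }
    where
    module M₁ = PartialTransversal M₁
    module M₂ = PartialTransversal M₂
    index : ℕ → ℕ
    index k with k <? j
    ... | yes _ = M₁.index k
    ... | no  _ = M₂.index k
    fits : ∀ {k} → T k ≡ true → InNℕ (index k) k
    fits {k} Tk with k <? j
    ... | yes k<j = M₁.index-fits (T₁⊇ Tk k<j)
    ... | no  k≮j = M₂.index-fits (T₂⊇ Tk (≮⇒≥ k≮j))
    separated : ∀ {k k'} → T k ≡ true → T k' ≡ true → k < j → j ≤ k' → M₁.index k < M₂.index k'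
    separated {k} {k'} Tk Tk' k<j j≤k' = begin-strict
      M₁.index k   <⟨ proj₂ (M₁.index-fits (T₁⊇ Tk k<j)) ⟩
      hQ (suc k)   ≤⟨ staircase-mono (prefixN-staircase Q) k<j ⟩
      hQ j         ≤⟨ hQ≤hP ⟩
      hP j         ≤⟨ staircase-mono (prefixN-staircase P) j≤k' ⟩
      hP k'        ≤⟨ proj₁ (M₂.index-fits (T₂⊇ Tk' j≤k')) ⟩
      M₂.index k'  ∎
      where open ≤-Reasoning
    injective : InjectiveOn (λ k → T k ≡ true) index
    injective {k} {k'} Tk Tk' e with k <? j | k' <? j
    ... | yes k<j | yes k'<j = M₁.index-injective (T₁⊇ Tk k<j) (T₁⊇ Tk' k'<j) e
    ... | no  k≮j | no  k'≮j = M₂.index-injective (T₂⊇ Tk (≮⇒≥ k≮j)) (T₂⊇ Tk' (≮⇒≥ k'≮j)) e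
    ... | yes k<j | no  k'≮j = ⊥-elim (<⇒≢ (separated Tk Tk' k<j (≮⇒≥ k'≮j)) e)
    ... | no  k≮j | yes k'<j = ⊥-elim (<⇒≢ (separated Tk' Tk k'<j (≮⇒≥ k≮j)) (sym e))

  -- If P and Q met at an inner step j, matchings of C − last before j and of C − first from j on
  -- would combine into one of C, for a circuit C through the first and the last element.
  connected⇒hP<hQ : Connected m r P Q → 2 ≤ n → ∀ {j} → 0 < j → j < n → hP j < hQ j
  connected⇒hP<hQ connected 2≤n {j} 0<j j<n with hP j <? hQ j
  ... | yes hP<hQ = hP<hQ
  ... | no  hP≮hQ = ⊥-elim (proj₁ C-circuit (partialTransversal⇒independent 0<r
                      (partialTransversal-split (≮⇒≥ hP≮hQ) M-last M-first before-last after-first)))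
    where
    0<n : 0 < n
    0<n = ≤-trans (s≤s z≤n) 2≤n
    n-1+1≡n : suc (pred n) ≡ n
    n-1+1≡n = suc-pred n ⦃ >-nonZero 0<n ⦄
    first last : Fin n
    first = fromℕ< 0<n
    last  = fromℕ< (≤-reflexive n-1+1≡n)
    toℕ-last : toℕ last ≡ pred n
    toℕ-last = toℕ-fromℕ< (≤-reflexive n-1+1≡n)
    first≢last : first ≢ last
    first≢last e = <⇒≢ (≤-pred (≤-trans 2≤n (≤-reflexive (sym n-1+1≡n))))
                       (trans (sym (toℕ-fromℕ< 0<n)) (trans (cong toℕ e) toℕ-last))
    common : Σ (Subset n) λ C → Circuit m r P Q C × first ∈ C × last ∈ C
    common = connected first last first≢last
    C : Subset n
    C = proj₁ common
    C-circuit : Circuit m r P Q C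
    C-circuit = proj₁ (proj₂ common)
    first∈C : first ∈ C
    first∈C = proj₁ (proj₂ (proj₂ common))
    M-first : PartialTransversal (lookupℕ C ∖ toℕ first)
    M-first = circuit-deletion C-circuit (∈⇒lookupℕ first∈C)
    M-last : PartialTransversal (lookupℕ C ∖ toℕ last)
    M-last = circuit-deletion C-circuit (∈⇒lookupℕ (proj₂ (proj₂ (proj₂ common))))
    0<r : 0 < r
    0<r = Fin⇒0< (proj₁ (proj₂ C-circuit (C - first) (x∈p⇒p-x⊂p first∈C)) first)
    before-last : ∀ {k} → lookupℕ C k ≡ true → k < j → (lookupℕ C ∖ toℕ last) k ≡ true
    before-last Ck k<j =
      trans (∖-≢ (lookupℕ C) λ e → <⇒≢ (<-≤-trans k<j (suc[m]≤n⇒m≤pred[n] j<n)) (trans e toℕ-last)) Ck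
    after-first : ∀ {k} → lookupℕ C k ≡ true → j ≤ k → (lookupℕ C ∖ toℕ first) k ≡ true
    after-first Ck j≤k =
      trans (∖-≢ (lookupℕ C) λ e → <⇒≱ 0<j (≤-trans j≤k (≤-reflexive (trans e (toℕ-fromℕ< 0<n))))) Ck

  -- k is the height of x in the circuit formed by the North steps of Q below height k before x,
  -- x itself, and the North steps of P from height k on after x.
  record Pivot (x k : ℕ) : Set where
    field
      k≤hQ  : k ≤ hQ x
      hP≤k  : hP (suc x) ≤ k
      below : 0 < k → hP x < k
      above : k < r → k < hQ (suc x)

  pivot-between : ∀ {a b x} → a < b → InNℕ a x → InNℕ b x → Pivot x (suc a)
  pivot-between {x = x} a<b (hPx≤a , _) (_ , b<hQ) = record
    { k≤hQ  = ≤-trans a<b (≤-pred (≤-trans b<hQ (proj₂ (prefixN-staircase Q x))))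
    ; hP≤k  = ≤-trans (proj₂ (prefixN-staircase P x)) (s≤s hPx≤a)
    ; below = λ _ → s≤s hPx≤a
    ; above = λ _ → ≤-<-trans a<b b<hQ
    }

  module _ (2≤n : 2 ≤ n) (strict : ∀ {j} → 0 < j → j < n → hP j < hQ j) where

    0<r : 0 < r
    0<r = ≤-trans (≤-<-trans z≤n (strict (s≤s z≤n) 2≤n)) (hQ≤r 1)

    pivot-first : ∀ {x} → x < n → InNℕ 0 x → ∃ (Pivot x)
    pivot-first {x} x<n 0∈@(hPx≤0 , 0<hQ) with 2 ≤? hQ (suc x) | suc x <? n
    ... | yes 2≤hQ | _ = _ , pivot-between (n<1+n 0) 0∈ (≤-trans hPx≤0 z≤n , 2≤hQ)
    ... | no 2≰hQ | yes x+1<n = 0 , record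
      { k≤hQ  = z≤n
      ; hP≤k  = ≤-pred (≤-trans (strict (s≤s z≤n) x+1<n) (≤-reflexive hQ≡1))
      ; below = λ ()
      ; above = λ _ → 0<hQ
      }
      where hQ≡1 : hQ (suc x) ≡ 1
            hQ≡1 = ≤-antisym (≤-pred (≰⇒> 2≰hQ)) 0<hQ
    ... | no 2≰hQ | no x+1≮n = 1 , record
      { k≤hQ  = ≤-trans (s≤s z≤n) (strict 0<x x<n)
      ; hP≤k  = ≤-trans (hP≤r _) (≤-reflexive r≡1)
      ; below = λ _ → s≤s hPx≤0
      ; above = λ 1<r → ⊥-elim (<-irrefl (sym r≡1) 1<r)
      }
      where x+1≡n : suc x ≡ n
            x+1≡n = ≤-antisym x<n (≮⇒≥ x+1≮n)
            r≡1 : r ≡ 1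
            r≡1 = trans (sym pathQ) (trans (cong hQ (sym x+1≡n)) (≤-antisym (≤-pred (≰⇒> 2≰hQ)) 0<hQ))
            0<x : 0 < x
            0<x = ≤-pred (≤-trans 2≤n (≤-reflexive (sym x+1≡n)))

    pivot-last : ∀ {a x} → x < n → suc a ≡ r → InNℕ a x → ∃ (Pivot x)
    pivot-last {a} {x} x<n a+1≡r a∈@(hPx≤a , a<hQ) with hP x <? a | 0 <? x
    ... | yes hP<a | _ = _ , pivot-between hP<a (≤-refl , <-trans hP<a a<hQ) a∈
    ... | no hP≮a | yes 0<x = r , record
      { k≤hQ  = ≤-trans (≤-reflexive (sym a+1≡r)) (≤-trans (s≤s (≤-reflexive (sym hP≡a))) (strict 0<x x<n))
      ; hP≤k  = hP≤r _
      ; below = λ _ → ≤-trans (s≤s (≤-reflexive hP≡a)) (≤-reflexive a+1≡r)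
      ; above = λ r<r → ⊥-elim (<-irrefl refl r<r)
      }
      where hP≡a : hP x ≡ a
            hP≡a = ≤-antisym hPx≤a (≮⇒≥ hP≮a)
    ... | no _ | no 0≮x = 0 , record
      { k≤hQ  = z≤n
      ; hP≤k  = subst (λ y → hP (suc y) ≤ 0) (sym (n≤0⇒n≡0 (≮⇒≥ 0≮x)))
                      (≤-pred (≤-trans (strict (s≤s z≤n) 2≤n) (prefixN≤ Q 1)))
      ; below = λ ()
      ; above = λ _ → ≤-<-trans z≤n a<hQ
      }

    pivot : ∀ {x} → InTwoOrExtremeN x → ∃ (Pivot (toℕ x))
    pivot (inj₁ (i , j , i≢j , i∈ , j∈)) with <-cmp (toℕ i) (toℕ j)
    ... | tri< i<j _ _ = _ , pivot-between i<j (InN⇒InNℕ i∈) (InN⇒InNℕ j∈)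
    ... | tri≈ _ i≡j _ = ⊥-elim (i≢j (toℕ-injective i≡j))
    ... | tri> _ _ j<i = _ , pivot-between j<i (InN⇒InNℕ j∈) (InN⇒InNℕ i∈)
    pivot {x} (inj₂ (inj₁ (i , i≡0 , i∈)))   = pivot-first (toℕ<n x) (subst (λ a → InNℕ a (toℕ x)) i≡0 (InN⇒InNℕ i∈))
    pivot {x} (inj₂ (inj₂ (i , i+1≡r , i∈))) = pivot-last (toℕ<n x) i+1≡r (InN⇒InNℕ i∈)

    module PivotCircuit {x : Fin n} {k} (pv : Pivot (toℕ x) k) where
      open Pivot pv

      x′ : ℕ
      x′ = toℕ x

      LeftOf RightOf Member : ℕ → Set
      LeftOf  j = j < x′ × lookupℕ Q j ≡ true × hQ j < k
      RightOf j = x′ < j × lookupℕ P j ≡ true × k ≤ hP j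
      Member  j = LeftOf j ⊎ (j ≡ x′ ⊎ RightOf j)

      pattern left   j<x Qj hQ<k = inj₁ (j<x , Qj , hQ<k)
      pattern centre j≡x         = inj₂ (inj₁ j≡x)
      pattern right  x<j Pj k≤hP = inj₂ (inj₂ (x<j , Pj , k≤hP))

      member? : ∀ j → Dec (Member j)
      member? j = (j <? x′ ×-dec lookupℕ Q j Boolₚ.≟ true ×-dec hQ j <? k)
                  ⊎-dec (j ≟ x′ ⊎-dec (x′ <? j ×-dec lookupℕ P j Boolₚ.≟ true ×-dec k ≤? hP j))

      C : Subset n
      C = tabulate (λ i → ⌊ member? (toℕ i) ⌋)

      inC⇒Member : ∀ {j} → lookupℕ C j ≡ true → Member j
      inC⇒Member {j} Cj =
        toWitness (Equivalence.from T-≡ (trans (sym (lookupℕ-tabulate (λ i → ⌊ member? i ⌋) (lookupℕ-true⇒< C Cj))) Cj))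

      Member⇒inC : ∀ {j} → j < n → Member j → lookupℕ C j ≡ true
      Member⇒inC j<n mj = trans (lookupℕ-tabulate (λ i → ⌊ member? i ⌋) j<n) (Equivalence.to T-≡ (fromWitness mj))

      height : ℕ → ℕ
      height j with <-cmp j x′
      ... | tri< _ _ _ = hQ j
      ... | tri≈ _ _ _ = k
      ... | tri> _ _ _ = suc (hP j)

      height-left : ∀ {j} → j < x′ → height j ≡ hQ j
      height-left {j} j<x with <-cmp j x′
      ... | tri< _ _ _    = refl
      ... | tri≈ j≮x _ _  = ⊥-elim (j≮x j<x)
      ... | tri> j≮x _ _  = ⊥-elim (j≮x j<x)

      height-centre : height x′ ≡ k
      height-centre with <-cmp x′ x′
      ... | tri< _ x≢x _ = ⊥-elim (x≢x refl)
      ... | tri≈ _ _ _   = refl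
      ... | tri> _ x≢x _ = ⊥-elim (x≢x refl)

      height-right : ∀ {j} → x′ < j → height j ≡ suc (hP j)
      height-right {j} x<j with <-cmp j x′
      ... | tri< _ _ x≮j = ⊥-elim (x≮j x<j)
      ... | tri≈ _ _ x≮j = ⊥-elim (x≮j x<j)
      ... | tri> _ _ _   = refl

      height-increasing : ∀ {j j'} → Member j → Member j' → j < j' → height j < height j'
      height-increasing (left j<x Qj _) (left j'<x _ _) j<j' rewrite height-left j<x | height-left j'<x =
        ≤-trans (≤-reflexive (sym (prefixN-suc-true Q Qj))) (staircase-mono (prefixN-staircase Q) j<j')
      height-increasing (left j<x _ hQ<k) (centre refl) _ rewrite height-left j<x | height-centre = hQ<k
      height-increasing (left j<x _ hQ<k) (right x<j' _ k≤hP) _ rewrite height-left j<x | height-right x<j' =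
        ≤-trans hQ<k (≤-trans k≤hP (n≤1+n _))
      height-increasing (centre refl) (left j'<x _ _) j<j' = ⊥-elim (<-asym j<j' j'<x)
      height-increasing (centre refl) (centre refl) j<j' = ⊥-elim (<-irrefl refl j<j')
      height-increasing (centre refl) (right x<j' _ k≤hP) _ rewrite height-centre | height-right x<j' = s≤s k≤hP
      height-increasing (right x<j _ _) (left j'<x _ _) j<j' = ⊥-elim (<-asym x<j (<-trans j<j' j'<x))
      height-increasing (right x<j _ _) (centre refl) j<j' = ⊥-elim (<-asym x<j j<j')
      height-increasing (right x<j Pj _) (right x<j' _ _) j<j' rewrite height-right x<j | height-right x<j' =
        s≤s (≤-trans (≤-reflexive (sym (prefixN-suc-true P Pj))) (staircase-mono (prefixN-staircase P) j<j'))

      left-fits : ∀ {j} → lookupℕ Q j ≡ true → InNℕ (hQ j) j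
      left-fits {j} Qj = P≤Q j , ≤-reflexive (sym (prefixN-suc-true Q Qj))

      left-fits-below : ∀ {j} → 0 < j → j < n → lookupℕ Q j ≡ true → InNℕ (pred (hQ j)) j
      left-fits-below {j} 0<j j<n Qj = suc[m]≤n⇒m≤pred[n] (strict 0<j j<n) ,
                                       ≤-trans (s≤s pred[n]≤n) (≤-reflexive (sym (prefixN-suc-true Q Qj)))

      right-fits : ∀ {j} → lookupℕ P j ≡ true → InNℕ (hP j) j
      right-fits {j} Pj = ≤-refl , ≤-trans (≤-reflexive (sym (prefixN-suc-true P Pj))) (P≤Q (suc j))

      right-fits-above : ∀ {j} → suc j < n → lookupℕ P j ≡ true → InNℕ (suc (hP j)) j
      right-fits-above {j} j+1<n Pj =
        n≤1+n _ , ≤-trans (≤-reflexive (cong suc (sym (prefixN-suc-true P Pj)))) (strict (s≤s z≤n) j+1<n)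

      centre-fits : k < r → InNℕ k x′
      centre-fits k<r = ≤-trans (proj₁ (prefixN-staircase P x′)) hP≤k , above k<r

      centre-fits-below : 0 < k → InNℕ (pred k) x′
      centre-fits-below 0<k = suc[m]≤n⇒m≤pred[n] (below 0<k) ,
                              ≤-trans (m≤pred[n]⇒suc[m]≤n ⦃ >-nonZero 0<k ⦄ ≤-refl) (≤-trans k≤hQ (proj₁ (prefixN-staircase Q x′)))

      member-right⇒k<r : ∀ {y} → Member y → x′ < y → k < r
      member-right⇒k<r (left y<x _ _)  x<y = ⊥-elim (<-asym x<y y<x)
      member-right⇒k<r (centre refl)   x<y = ⊥-elim (<-irrefl refl x<y)
      member-right⇒k<r (right _ Py k≤hP) _ =
        ≤-trans (s≤s k≤hP) (≤-trans (≤-reflexive (sym (prefixN-suc-true P Py))) (hP≤r _))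

      member-left⇒0<k : ∀ {y} → Member y → y < x′ → 0 < k
      member-left⇒0<k (left _ _ hQ<k)  _   = ≤-<-trans z≤n hQ<k
      member-left⇒0<k (centre refl)    y<x = ⊥-elim (<-irrefl refl y<x)
      member-left⇒0<k (right x<y _ _)  y<x = ⊥-elim (<-asym x<y y<x)

      shifted : ℕ → ℕ → ℕ
      shifted y j with j <? y
      ... | yes _ = height j
      ... | no  _ = pred (height j)

      shifted-fits : ∀ {y j} → Member y → y < n → Member j → j < n → j ≢ y → InNℕ (shifted y j) j
      shifted-fits {y} {j} my y<n mj j<n j≢y with j <? y
      shifted-fits my y<n (left j<x Qj _)   j<n j≢y | yes j<y rewrite height-left j<x = left-fits Qj
      shifted-fits my y<n (centre refl)     j<n j≢y | yes x<y rewrite height-centre = centre-fits (member-right⇒k<r my x<y)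
      shifted-fits my y<n (right x<j Pj _)  j<n j≢y | yes j<y rewrite height-right x<j = right-fits-above (<-≤-trans (s≤s j<y) y<n) Pj
      shifted-fits my y<n (left j<x Qj _)   j<n j≢y | no j≮y rewrite height-left j<x =
        left-fits-below (≤-<-trans z≤n (≤∧≢⇒< (≮⇒≥ j≮y) (j≢y ∘ sym))) j<n Qj
      shifted-fits my y<n (centre refl)     j<n j≢y | no x≮y rewrite height-centre =
        centre-fits-below (member-left⇒0<k my (≤∧≢⇒< (≮⇒≥ x≮y) (j≢y ∘ sym)))
      shifted-fits my y<n (right x<j Pj _)  j<n j≢y | no j≮y rewrite height-right x<j = right-fits Pj

      shifted-increasing : ∀ {y j j'} → Member y → Member j → Member j' → j ≢ y → j' ≢ y → j < j' →
                           shifted y j < shifted y j'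
      shifted-increasing {y} {j} {j'} my mj mj' j≢y j'≢y j<j' with j <? y | j' <? y
      ... | yes _   | yes _    = height-increasing mj mj' j<j'
      ... | no j≮y  | no _     =
        pred-mono-< ⦃ >-nonZero (≤-<-trans z≤n (height-increasing my mj y<j)) ⦄ (height-increasing mj mj' j<j')
        where y<j : y < j
              y<j = ≤∧≢⇒< (≮⇒≥ j≮y) (j≢y ∘ sym)
      ... | yes j<y | no j'≮y  = <-≤-trans (height-increasing mj my j<y) (suc[m]≤n⇒m≤pred[n] (height-increasing my mj' y<j'))
        where y<j' : y < j'
              y<j' = ≤∧≢⇒< (≮⇒≥ j'≮y) (j'≢y ∘ sym)
      ... | no j≮y  | yes j'<y = ⊥-elim (j≮y (<-trans j<j' j'<y))

      deletion-partialTransversal : ∀ {y} → lookupℕ C y ≡ true → PartialTransversal (lookupℕ C ∖ y)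
      deletion-partialTransversal {y} Cy = record
        { index           = shifted y
        ; index-fits      = λ C∖yj → let Cj , j≢y = ∖⇒ (lookupℕ C) C∖yj in
                              shifted-fits (inC⇒Member Cy) (lookupℕ-true⇒< C Cy) (inC⇒Member Cj) (lookupℕ-true⇒< C Cj) j≢y
        ; index-injective = increasing⇒injectiveOn λ C∖yj C∖yj' →
                              let Cj , j≢y = ∖⇒ (lookupℕ C) C∖yj ; Cj' , j'≢y = ∖⇒ (lookupℕ C) C∖yj' in
                              shifted-increasing (inC⇒Member Cy) (inC⇒Member Cj) (inC⇒Member Cj') j≢y j'≢y
        }

      enumerate : ∀ t → t ≤ r → ∃ λ j → j < n × Member j × height j ≡ t
      enumerate t t≤r with <-cmp t k
      ... | tri< t<k _ _ = let a , a<x , Qa , hQa≡t = prefixN-attains Q x′ (<-≤-trans t<k k≤hQ) in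
        a , <-trans a<x (toℕ<n x) , left a<x Qa (subst (_< k) (sym hQa≡t) t<k) , trans (height-left a<x) hQa≡t
      ... | tri≈ _ refl _ = x′ , toℕ<n x , centre refl , height-centre
      enumerate (suc t) t+1≤r | tri> _ _ (s≤s k≤t) with prefixN-attains P n (≤-trans t+1≤r (≤-reflexive (sym pathP)))
      ... | b , b<n , Pb , hPb≡t = b , b<n , right x<b Pb k≤hPb , trans (height-right x<b) (cong suc hPb≡t)
        where
        k≤hPb : k ≤ hP b
        k≤hPb = ≤-trans k≤t (≤-reflexive (sym hPb≡t))
        x<b : x′ < b
        x<b = ≤-pred (staircase-<⇒< (prefixN-staircase P)
                (≤-<-trans (≤-trans hP≤k k≤hPb) (≤-reflexive (sym (prefixN-suc-true P Pb)))))

      enumerate-Fin : (t : Fin (suc r)) → ∃ λ j → j < n × Member j × height j ≡ toℕ t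
      enumerate-Fin t = enumerate (toℕ t) (≤-pred (toℕ<n t))

      element : Fin (suc r) → Fin n
      element t = fromℕ< (proj₁ (proj₂ (enumerate-Fin t)))

      toℕ-element : ∀ t → toℕ (element t) ≡ proj₁ (enumerate-Fin t)
      toℕ-element t = toℕ-fromℕ< (proj₁ (proj₂ (enumerate-Fin t)))

      element-Member : ∀ t → Member (toℕ (element t))
      element-Member t = subst Member (sym (toℕ-element t)) (proj₁ (proj₂ (proj₂ (enumerate-Fin t))))

      height-element : ∀ t → height (toℕ (element t)) ≡ toℕ t
      height-element t = trans (cong height (toℕ-element t)) (proj₂ (proj₂ (proj₂ (enumerate-Fin t))))

      element∈C : ∀ t → element t ∈ C
      element∈C t = lookupℕ⇒∈ (Member⇒inC (toℕ<n (element t)) (element-Member t))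

      element-injective : ∀ {t t'} → element t ≡ element t' → t ≡ t'
      element-injective {t} {t'} e =
        toℕ-injective (trans (sym (height-element t)) (trans (cong (height ∘ toℕ) e) (height-element t')))

      C-minimal : ∀ D → D ⊂ C → Independent m r P Q D
      C-minimal D (D⊆C , y , y∈C , y∉D) =
        partialTransversal⇒independent 0<r (partialTransversal-⊆ D⊆C∖y (deletion-partialTransversal (∈⇒lookupℕ y∈C)))
        where
        D⊆C∖y : ∀ {j} → lookupℕ D j ≡ true → (lookupℕ C ∖ toℕ y) j ≡ true
        D⊆C∖y {j} Dj with lookupℕ⇒Fin D j Dj
        ... | z , refl , z∈D =
          trans (∖-≢ (lookupℕ C) (λ e → y∉D (subst (_∈ D) (toℕ-injective e) z∈D))) (∈⇒lookupℕ (D⊆C z∈D))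

      x∈C : x ∈ C
      x∈C = lookupℕ⇒∈ (Member⇒inC (toℕ<n x) (centre refl))

      B : Subset n
      B = C - x

      B-maximal : ∀ y → y ∉ B → ¬ Independent m r P Q (⁅ y ⁆ ∪ B)
      B-maximal y y∉B = r+1-elements⇒dependent swapped swapped∈ swapped-injective
        where
        swapped : Fin (suc r) → Fin n
        swapped t with toℕ t ≟ k
        ... | yes _ = y
        ... | no  _ = element t
        element∈B : ∀ {t} → toℕ t ≢ k → element t ∈ B
        element∈B {t} t≢k = x∈p∧x≢y⇒x∈p-y (element∈C t)
                              (λ e → t≢k (trans (sym (height-element t)) (trans (cong (height ∘ toℕ) e) height-centre)))
        swapped∈ : ∀ t → swapped t ∈ ⁅ y ⁆ ∪ B
        swapped∈ t with toℕ t ≟ k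
        ... | yes _   = x∈p∪q⁺ (inj₁ (x∈⁅x⁆ y))
        ... | no  t≢k = x∈p∪q⁺ (inj₂ (element∈B t≢k))
        swapped-injective : ∀ {t t'} → swapped t ≡ swapped t' → t ≡ t'
        swapped-injective {t} {t'} e with toℕ t ≟ k | toℕ t' ≟ k
        ... | yes t≡k | yes t'≡k = toℕ-injective (trans t≡k (sym t'≡k))
        ... | yes _   | no t'≢k  = ⊥-elim (y∉B (subst (_∈ B) (sym e) (element∈B t'≢k)))
        ... | no t≢k  | yes _    = ⊥-elim (y∉B (subst (_∈ B) e (element∈B t≢k)))
        ... | no _    | no _     = element-injective e

      spanningCircuit : SpanningCircuit m r P Q C
      spanningCircuit = (r+1-elements⇒dependent element element∈C element-injective , C-minimal) ,
                        (B , p─q⊆p C ⁅ x ⁆ , C-minimal B (x∈p⇒p-x⊂p x∈C) , B-maximal)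

  InTwoOrExtremeN⇒spanningCircuit : Connected m r P Q → 2 ≤ n → ∀ {x} → InTwoOrExtremeN x →
                                    Σ (Subset n) λ C → SpanningCircuit m r P Q C × x ∈ C
  InTwoOrExtremeN⇒spanningCircuit connected 2≤n x∈Ns = C , spanningCircuit , x∈C
    where
    strict : ∀ {j} → 0 < j → j < n → hP j < hQ j
    strict = connected⇒hP<hQ connected 2≤n
    open PivotCircuit 2≤n strict (proj₂ (pivot 2≤n strict x∈Ns))

theorem3p6 : (m r : ℕ) → (P Q : Vec Bool (m + r)) →
    IsPath m r P → IsPath m r Q → Below P Q →
    Connected m r P Q → 2 ≤ m + r →
    (x : Fin (m + r)) →
    (Σ (Subset (m + r)) (λ C → SpanningCircuit m r P Q C × x ∈ C))
      ⇔ ((Σ (Fin r) (λ i → Σ (Fin r) (λ j → ¬ (i ≡ j) × InN m r P Q i x × InN m r P Q j x)))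
         ⊎ ((Σ (Fin r) (λ i → toℕ i ≡ 0 × InN m r P Q i x))
           ⊎ (Σ (Fin r) (λ i → suc (toℕ i) ≡ r × InN m r P Q i x))))
theorem3p6 m r P Q pathP pathQ P≤Q connected 2≤n x =
  mk⇔ (λ (C , C-spanningCircuit , x∈C) → spanningCircuit⇒InTwoOrExtremeN C-spanningCircuit x∈C)
      (InTwoOrExtremeN⇒spanningCircuit connected 2≤n)
  where open LatticePathMatroid m r P Q pathP pathQ P≤Q
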